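{- Let $p$ be a prime. Let $a,b$ be integers with $1\le b\le a$, $\nu(a-b)=0$, and $\{\nu(a),\nu(b)\}=\{0,k\}$ for some integer $k\ge0$, and let $c,d\in\mathbb{Z}$ (possibly negative). Then the limit $\binom{ap^\infty+c}{bp^\infty+d}:=\lim_{e\to\infty}\binom{ap^e+c}{bp^e+d}$ exists in $\mathbb{Z}_p$ and $$\binom{ap^\infty+c}{bp^\infty+d}=\begin{cases}\binom{ap^\infty}{bp^\infty}\binom cd & c,d\ge0,\\[2pt] \binom{ap^\infty}{bp^\infty}\binom cd\frac{a-b}{a} & c<0\le d,\\[2pt] \binom{ap^\infty}{bp^\infty}\binom c{c-d}\frac ba & c<0\le c-d,\\[2pt] 0&\text{otherwise,}\end{cases}$$ where $\binom{ap^\infty}{bp^\infty}:=\lim_{e\to\infty}\binom{ap^e}{bp^e}$ (which exists in $\mathbb{Z}_p$).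
   Context: $\nu(n)$ denotes the exponent of the prime $p$ in a positive integer $n$. Limits are $p$-adic, in the metric $d(x,y)=p^{ -\nu(x-y)}$ on $\mathbb{Z}_p$; the binomial coefficients $\binom{ap^e+c}{bp^e+d}$ are considered for $e$ large enough that $ap^e+c>0$ and $bp^e+d>0$. For $c\in\mathbb{Z}$ and an integer $d\ge0$, $\binom cd:=c(c-1)\cdots(c-d+1)/d!$. -}

module Defs where

open import Data.Nat as ℕ using (ℕ; zero; suc; _!; _^_)
open import Data.Nat.Properties using (_!≢0)
open import Data.Nat.Divisibility as ℕD using ()
open import Data.Integer as ℤ using (ℤ; +_; _/ℕ_)
open import Data.Integer.Divisibility as ℤD using ()
open import Data.Product using (_×_; ∃)
open import Relation.Nullary using (¬_)

-- p-adic valuation statement: ν_p(n) = k, i.e. p^k ∣ n and p^(k+1) ∤ n.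
-- (For n = 0 this never holds, matching ν(0) = ∞.)
HasVal : ℕ → ℕ → ℕ → Set
HasVal p n k = (p ^ k) ℕD.∣ n × ¬ ((p ^ suc k) ℕD.∣ n)

falling : ℤ → ℕ → ℤ
falling c zero    = + 1
falling c (suc d) = falling c d ℤ.* (c ℤ.- + d)

-- generalized binomial coefficient (c choose d) := c(c-1)...(c-d+1)/d!
-- (the division is exact)
binom : ℤ → ℕ → ℤ
binom c d = _/ℕ_ (falling c d) (d !) {{d !≢0}}

-- p-adic convergence (Cauchy in Z_p, which is complete) of an integer sequence
PConverges : ℕ → (ℕ → ℤ) → Set
PConverges p x = ∀ N → ∃ λ E → ∀ e e′ → E ℕ.≤ e → E ℕ.≤ e′ →
  (+ (p ^ N)) ℤD.∣ (x e ℤ.- x e′)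

PNull : ℕ → (ℕ → ℤ) → Set
PNull p x = ∀ N → ∃ λ E → ∀ e → E ℕ.≤ e → (+ (p ^ N)) ℤD.∣ x e

-- the sequence e ↦ binom(a p^e + c, b p^e + d); the lower index is taken as
-- |b p^e + d|, which equals b p^e + d for all e large enough (only those matter).
Seq : ℕ → ℕ → ℕ → ℤ → ℤ → ℕ → ℤ
Seq p a b c d e = binom (+ (a ℕ.* p ^ e) ℤ.+ c) ℤ.∣ + (b ℕ.* p ^ e) ℤ.+ d ∣

{-# OPTIONS --safe #-}
-- The central coefficients binom(a p^e, b p^e) are p-adically Cauchy: the ratio of
-- binom(pR + pM, pM) to binom(R + M, M) is a quotient of products of blocks (y+1)⋯(y+p−1)
-- that are units mod p and congruent mod pR, so binom(a p^(e+1), b p^(e+1)) ≡ binom(a p^e, b p^e)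
-- mod p^(e+1).  For the shifted coefficients, the defect a·binom(a p^e + c, b p^e + d) minus
-- binom(a p^e, b p^e) times a·(claimed limit ratio) satisfies Pascal's rule in (c, d), so it
-- suffices that it tends to 0 on the row c = 0 and on the column d = 0, c < 0.  There, up to a
-- unit factor, the coefficient is congruent mod p^e to a product with a factor divisible by p^e.
-- Dividing by a loses only boundedly many powers of p.
module Submission where

open import Defs
open import Data.Nat as ℕ using (ℕ; zero; suc; _!; _^_)
open import Data.Nat.Primality using (Prime; euclidsLemma; prime⇒nonZero; prime⇒nonTrivial)
open import Data.Integer as ℤ using (ℤ; +_; -[1+_]; _+_; _-_; _*_; -_; ∣_∣; 0ℤ; _/ℕ_; _%ℕ_)
open import Data.Product using (_×_; ∃; _,_)
open import Data.Sum using (_⊎_; inj₁; inj₂)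
open import Relation.Nullary using (¬_; yes; no; contradiction)

import Data.Nat.Properties as ℕP
open import Data.Nat.Properties using (_!≢0)
import Data.Nat.Divisibility as ℕ∣
import Data.Nat.Tactic.RingSolver as ℕ-Solver
import Data.Integer.Properties as ℤP
import Data.Integer.DivMod as ℤDM
open import Data.Integer.Divisibility.Signed as ℤ∣ using (_∣_; divides)
open import Data.Integer.Tactic.RingSolver using (solve-∀)
open import Relation.Binary.PropositionalEquality
open import Relation.Binary.Bundles using (Setoid)
import Relation.Binary.Reasoning.Setoid as SetoidReasoning

rising : ℤ → ℕ → ℤ
rising x zero    = + 1
rising x (suc t) = rising x t * (x + + suc t)

falling-suc : ∀ x d → falling (x + + 1) (suc d) ≡ (x + + 1) * falling x d
falling-suc x zero    = single-factor x
  where single-factor : ∀ x → + 1 * (x + + 1 - + 0) ≡ (x + + 1) * + 1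
        single-factor = solve-∀
falling-suc x (suc d) = begin
  falling (x + + 1) (suc d) * (x + + 1 - + suc d) ≡⟨ cong₂ _*_ (falling-suc x d) (cong (λ n → x + + 1 - n) (ℤP.pos-+ 1 d)) ⟩
  (x + + 1) * falling x d * (x + + 1 - (+ 1 + + d)) ≡⟨ rearrange x (falling x d) (+ d) ⟩
  (x + + 1) * (falling x d * (x - + d))             ∎
  where
  open ≡-Reasoning
  rearrange : ∀ x f d → (x + + 1) * f * (x + + 1 - (+ 1 + d)) ≡ (x + + 1) * (f * (x - d))
  rearrange = solve-∀

falling-pascal : ∀ x d → falling (x + + 1) (suc d) ≡ falling x (suc d) + + suc d * falling x d
falling-pascal x d = begin
  falling (x + + 1) (suc d)                     ≡⟨ falling-suc x d ⟩
  (x + + 1) * falling x d                       ≡⟨ split x (falling x d) (+ d) ⟩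
  falling x d * (x - + d) + (+ 1 + + d) * falling x d ≡⟨ cong (λ n → falling x (suc d) + n * falling x d) (ℤP.pos-+ 1 d) ⟨
  falling x (suc d) + + suc d * falling x d      ∎
  where
  open ≡-Reasoning
  split : ∀ x f d → (x + + 1) * f ≡ f * (x - d) + (+ 1 + d) * f
  split = solve-∀

falling-+ : ∀ x k t → falling x (k ℕ.+ t) ≡ falling x k * falling (x - + k) t
falling-+ x k zero    = trans (cong (falling x) (ℕP.+-identityʳ k)) (sym (ℤP.*-identityʳ _))
falling-+ x k (suc t) = begin
  falling x (k ℕ.+ suc t)                                   ≡⟨ cong (falling x) (ℕP.+-suc k t) ⟩
  falling x (k ℕ.+ t) * (x - + (k ℕ.+ t))                   ≡⟨ cong₂ (λ f n → f * (x - n)) (falling-+ x k t) (ℤP.pos-+ k t) ⟩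
  falling x k * falling (x - + k) t * (x - (+ k + + t))     ≡⟨ regroup (falling x k) (falling (x - + k) t) x (+ k) (+ t) ⟩
  falling x k * (falling (x - + k) t * (x - + k - + t))     ∎
  where
  open ≡-Reasoning
  regroup : ∀ f g x k t → f * g * (x - (k + t)) ≡ f * (g * (x - k - t))
  regroup = solve-∀

falling≡rising : ∀ x t → falling (x + + t) t ≡ rising x t
falling≡rising x zero    = refl
falling≡rising x (suc t) = begin
  falling (x + + suc t) (suc t)         ≡⟨ cong (λ y → falling y (suc t)) (shift x t) ⟩
  falling (x + + t + + 1) (suc t)       ≡⟨ falling-suc (x + + t) t ⟩
  (x + + t + + 1) * falling (x + + t) t ≡⟨ cong₂ _*_ (sym (shift x t)) (falling≡rising x t) ⟩
  (x + + suc t) * rising x t            ≡⟨ ℤP.*-comm (x + + suc t) (rising x t) ⟩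
  rising x (suc t)                      ∎
  where
  open ≡-Reasoning
  shift : ∀ x t → x + + suc t ≡ x + + t + + 1
  shift x t = trans (cong (_+_ x) (trans (cong +_ (ℕP.+-comm 1 t)) (ℤP.pos-+ t 1))) (sym (ℤP.+-assoc x (+ t) (+ 1)))

factorial*rising : ∀ s t → + (s !) * rising (+ s) t ≡ + ((s ℕ.+ t) !)
factorial*rising s zero    = trans (ℤP.*-identityʳ _) (cong (λ n → + (n !)) (sym (ℕP.+-identityʳ s)))
factorial*rising s (suc t) = begin
  + (s !) * (rising (+ s) t * + (s ℕ.+ suc t))  ≡⟨ ℤP.*-assoc (+ (s !)) _ _ ⟨
  + (s !) * rising (+ s) t * + (s ℕ.+ suc t)    ≡⟨ cong₂ _*_ (factorial*rising s t) (cong +_ (ℕP.+-suc s t)) ⟩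
  + ((s ℕ.+ t) !) * + suc (s ℕ.+ t)            ≡⟨ ℤP.pos-* ((s ℕ.+ t) !) (suc (s ℕ.+ t)) ⟨
  + ((s ℕ.+ t) ! ℕ.* suc (s ℕ.+ t))            ≡⟨ cong +_ (ℕP.*-comm ((s ℕ.+ t) !) _) ⟩
  + (suc (s ℕ.+ t) !)                          ≡⟨ cong (λ n → + (n !)) (ℕP.+-suc s t) ⟨
  + ((s ℕ.+ suc t) !)                          ∎
  where open ≡-Reasoning

falling-zero : ∀ d → falling (+ 0) (suc d) ≡ 0ℤ
falling-zero zero    = refl
falling-zero (suc d) = cong (_* (+ 0 - + suc d)) (falling-zero d)

∣falling : ∀ x t → x ∣ falling x (suc t)
∣falling x zero    = divides (+ 1) (cong (+ 1 *_) (ℤP.+-identityʳ x))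
∣falling x (suc t) = ℤ∣.∣m⇒∣m*n _ (∣falling x t)

rising-zero : ∀ t → rising (+ 0) t ≡ + (t !)
rising-zero t = trans (sym (ℤP.*-identityˡ _)) (factorial*rising 0 t)

falling-self : ∀ t → falling (+ t) t ≡ + (t !)
falling-self t = trans (falling≡rising (+ 0) t) (rising-zero t)

rising-neg≢0 : ∀ t → rising -[1+ t ] t ≢ 0ℤ
rising-neg≢0 t = nonzero t ℕP.≤-refl
  where
  nonzero : ∀ i → i ℕ.≤ t → rising -[1+ t ] i ≢ 0ℤ
  nonzero zero    _   ()
  nonzero (suc i) i<t eq with ℤP.i*j≡0⇒i≡0∨j≡0 (rising -[1+ t ] i) eq
  ... | inj₁ h = nonzero i (ℕP.<⇒≤ i<t) h
  ... | inj₂ h = ℕP.<⇒≢ i<t (ℕP.suc-injective (ℤP.+-injective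
                   (ℤP.i-j≡0⇒i≡j (+ suc i) (+ suc t) (trans (ℤP.+-comm (+ suc i) -[1+ t ]) h))))

ℤ-induction : (P : ℤ → Set) → P (+ 0) → (∀ c → P c → P (c + + 1)) → (∀ c → P (c + + 1) → P c) →
              ∀ c → P c
ℤ-induction P P0 up down (+ zero)     = P0
ℤ-induction P P0 up down (+ suc n)    =
  subst P (cong +_ (ℕP.+-comm n 1)) (up (+ n) (ℤ-induction P P0 up down (+ n)))
ℤ-induction P P0 up down -[1+ zero ]  = down -[1+ 0 ] P0
ℤ-induction P P0 up down -[1+ suc n ] = down -[1+ suc n ] (ℤ-induction P P0 up down -[1+ n ])

factorial∣falling : ∀ c d → + (d !) ∣ falling c d
factorial∣falling = ℤ-induction _ at-zero up down
  where
  1∣ : ∀ x → + 1 ∣ x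
  1∣ x = divides x (sym (ℤP.*-identityʳ x))

  suc-factorial : ∀ d → + (suc d !) ≡ + suc d * + (d !)
  suc-factorial d = ℤP.pos-* (suc d) (d !)

  at-zero : ∀ d → + (d !) ∣ falling (+ 0) d
  at-zero zero    = 1∣ _
  at-zero (suc d) = subst (+ (suc d !) ∣_) (sym (falling-zero d)) (divides 0ℤ refl)

  up : ∀ c → (∀ d → + (d !) ∣ falling c d) → ∀ d → + (d !) ∣ falling (c + + 1) d
  up c h zero    = 1∣ _
  up c h (suc d) = subst (+ (suc d !) ∣_) (sym (falling-pascal c d))
    (ℤ∣.∣m∣n⇒∣m+n (h (suc d)) (subst (_∣ + suc d * falling c d) (sym (suc-factorial d)) (ℤ∣.*-monoʳ-∣ (+ suc d) (h d))))

  down : ∀ c → (∀ d → + (d !) ∣ falling (c + + 1) d) → ∀ d → + (d !) ∣ falling c d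
  down c h zero    = 1∣ _
  down c h (suc d) = subst (+ (suc d !) ∣_) (trans (cong (_- + suc d * falling c d) (falling-pascal c d)) (cancel (falling c (suc d)) _))
    (ℤ∣.∣m∣n⇒∣m-n (h (suc d)) (subst (_∣ + suc d * falling c d) (sym (suc-factorial d)) (ℤ∣.*-monoʳ-∣ (+ suc d) (down c h d))))
    where
    cancel : ∀ u v → u + v - v ≡ u
    cancel = solve-∀

/ℕ-exact : ∀ z d .{{_ : ℕ.NonZero d}} → + d ∣ z → (z /ℕ d) * + d ≡ z
/ℕ-exact z d d∣z = sym (begin
  z                           ≡⟨ ℤDM.a≡a%ℕn+[a/ℕn]*n z d ⟩
  + (z %ℕ d) + (z /ℕ d) * + d ≡⟨ cong (λ r → + r + (z /ℕ d) * + d) (%ℕ≡0 z (ℤ∣.∣⇒∣ᵤ d∣z)) ⟩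
  + 0 + (z /ℕ d) * + d        ≡⟨ ℤP.+-identityˡ _ ⟩
  (z /ℕ d) * + d              ∎)
  where
  open ≡-Reasoning
  %ℕ≡0 : ∀ z → d ℕ∣.∣ ∣ z ∣ → z %ℕ d ≡ 0
  %ℕ≡0 (+ n)    d∣n = ℕ∣.n∣m⇒m%n≡0 n d d∣n
  %ℕ≡0 -[1+ n ] d∣n with suc n ℕ.% d | ℕ∣.n∣m⇒m%n≡0 (suc n) d d∣n
  ... | zero | _ = refl

binom*factorial : ∀ c d → binom c d * + (d !) ≡ falling c d
binom*factorial c d = /ℕ-exact (falling c d) (d !) {{d !≢0}} (factorial∣falling c d)

binom-unique : ∀ c d y → y * + (d !) ≡ falling c d → binom c d ≡ y
binom-unique c d y eq =
  ℤP.*-cancelʳ-≡ (binom c d) y (+ (d !)) {{d !≢0}} (trans (binom*factorial c d) (sym eq))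

binom-zero : ∀ k → binom (+ 0) (suc k) ≡ 0ℤ
binom-zero k = binom-unique (+ 0) (suc k) 0ℤ (sym (falling-zero k))

binom-pascal : ∀ x k → binom (x + + 1) (suc k) ≡ binom x k + binom x (suc k)
binom-pascal x k = binom-unique (x + + 1) (suc k) _ (begin
  (binom x k + binom x (suc k)) * + (suc k !)
    ≡⟨ cong ((binom x k + binom x (suc k)) *_) (ℤP.pos-* (suc k) (k !)) ⟩
  (binom x k + binom x (suc k)) * (+ suc k * + (k !))
    ≡⟨ expand (binom x k) (binom x (suc k)) (+ suc k) (+ (k !)) ⟩
  binom x (suc k) * (+ suc k * + (k !)) + + suc k * (binom x k * + (k !))
    ≡⟨ cong₂ (λ u v → binom x (suc k) * u + + suc k * v) (sym (ℤP.pos-* (suc k) (k !))) (binom*factorial x k) ⟩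
  binom x (suc k) * + (suc k !) + + suc k * falling x k
    ≡⟨ cong (_+ + suc k * falling x k) (binom*factorial x (suc k)) ⟩
  falling x (suc k) + + suc k * falling x k
    ≡⟨ falling-pascal x k ⟨
  falling (x + + 1) (suc k) ∎)
  where
  open ≡-Reasoning
  expand : ∀ u v s f → (u + v) * (s * f) ≡ v * (s * f) + s * (u * f)
  expand = solve-∀

binom-absorb : ∀ x s → binom (x + + 1) (suc s) * + suc s ≡ binom x s * (x + + 1)
binom-absorb x s = ℤP.*-cancelʳ-≡ _ _ (+ (s !)) {{s !≢0}} (begin
  binom (x + + 1) (suc s) * + suc s * + (s !)   ≡⟨ ℤP.*-assoc (binom (x + + 1) (suc s)) _ _ ⟩
  binom (x + + 1) (suc s) * (+ suc s * + (s !)) ≡⟨ cong (binom (x + + 1) (suc s) *_) (ℤP.pos-* (suc s) (s !)) ⟨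
  binom (x + + 1) (suc s) * + (suc s !)         ≡⟨ binom*factorial (x + + 1) (suc s) ⟩
  falling (x + + 1) (suc s)                     ≡⟨ falling-suc x s ⟩
  (x + + 1) * falling x s                       ≡⟨ cong ((x + + 1) *_) (binom*factorial x s) ⟨
  (x + + 1) * (binom x s * + (s !))             ≡⟨ swap (x + + 1) (binom x s) (+ (s !)) ⟩
  binom x s * (x + + 1) * + (s !)               ∎)
  where
  open ≡-Reasoning
  swap : ∀ y u f → y * (u * f) ≡ u * y * f
  swap = solve-∀

binom-lower-shift : ∀ x s t → binom x (s ℕ.+ t) * rising (+ s) t ≡ binom x s * falling (x - + s) t
binom-lower-shift x s t = ℤP.*-cancelʳ-≡ _ _ (+ (s !)) {{s !≢0}} (begin
  binom x (s ℕ.+ t) * rising (+ s) t * + (s !)   ≡⟨ swap (binom x (s ℕ.+ t)) (rising (+ s) t) (+ (s !)) ⟩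
  binom x (s ℕ.+ t) * (+ (s !) * rising (+ s) t) ≡⟨ cong (binom x (s ℕ.+ t) *_) (factorial*rising s t) ⟩
  binom x (s ℕ.+ t) * + ((s ℕ.+ t) !)           ≡⟨ binom*factorial x (s ℕ.+ t) ⟩
  falling x (s ℕ.+ t)                           ≡⟨ falling-+ x s t ⟩
  falling x s * falling (x - + s) t             ≡⟨ cong (_* falling (x - + s) t) (binom*factorial x s) ⟨
  binom x s * + (s !) * falling (x - + s) t     ≡⟨ swap′ (binom x s) (+ (s !)) (falling (x - + s) t) ⟩
  binom x s * falling (x - + s) t * + (s !)     ∎)
  where
  open ≡-Reasoning
  swap : ∀ u r f → u * r * f ≡ u * (f * r)
  swap = solve-∀
  swap′ : ∀ u f r → u * f * r ≡ u * r * f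
  swap′ = solve-∀

binom-upper-shift : ∀ x k t → binom (x + + t) k * rising (x - + k) t ≡ binom x k * rising x t
binom-upper-shift x k t = ℤP.*-cancelʳ-≡ _ _ (+ (k !)) {{k !≢0}} (begin
  binom (x + + t) k * rising (x - + k) t * + (k !)
    ≡⟨ swap (binom (x + + t) k) (rising (x - + k) t) (+ (k !)) ⟩
  binom (x + + t) k * + (k !) * rising (x - + k) t
    ≡⟨ cong₂ _*_ (binom*factorial (x + + t) k) (sym (falling≡rising (x - + k) t)) ⟩
  falling (x + + t) k * falling (x - + k + + t) t
    ≡⟨ cong (λ y → falling (x + + t) k * falling y t) (comm x (+ k) (+ t)) ⟩
  falling (x + + t) k * falling (x + + t - + k) t
    ≡⟨ falling-+ (x + + t) k t ⟨
  falling (x + + t) (k ℕ.+ t)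
    ≡⟨ cong (falling (x + + t)) (ℕP.+-comm k t) ⟩
  falling (x + + t) (t ℕ.+ k)
    ≡⟨ falling-+ (x + + t) t k ⟩
  falling (x + + t) t * falling (x + + t - + t) k
    ≡⟨ cong₂ _*_ (falling≡rising x t) (cong (λ y → falling y k) (cancel x (+ t))) ⟩
  rising x t * falling x k
    ≡⟨ cong (rising x t *_) (binom*factorial x k) ⟨
  rising x t * (binom x k * + (k !))
    ≡⟨ swap′ (rising x t) (binom x k) (+ (k !)) ⟩
  binom x k * rising x t * + (k !) ∎)
  where
  open ≡-Reasoning
  swap : ∀ u r f → u * r * f ≡ u * f * r
  swap = solve-∀
  swap′ : ∀ r u f → r * (u * f) ≡ u * r * f
  swap′ = solve-∀
  comm : ∀ x k t → x - k + t ≡ x + t - k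
  comm = solve-∀
  cancel : ∀ x t → x + t - t ≡ x
  cancel = solve-∀

binom-diagonal-shift : ∀ x m t →
  binom (x + + (m ℕ.+ t)) (m ℕ.+ t) * rising (+ m) t ≡ binom (x + + m) m * rising (x + + m) t
binom-diagonal-shift x m t = begin
  binom (x + + (m ℕ.+ t)) (m ℕ.+ t) * rising (+ m) t
    ≡⟨ binom-lower-shift (x + + (m ℕ.+ t)) m t ⟩
  binom (x + + (m ℕ.+ t)) m * falling (x + + (m ℕ.+ t) - + m) t
    ≡⟨ cong₂ (λ y z → binom y m * falling z t) (assoc x m t) (drop x m t) ⟩
  binom (x + + m + + t) m * falling (x + + t) t
    ≡⟨ cong (binom (x + + m + + t) m *_) (trans (falling≡rising x t) (cong (λ y → rising y t) (sym (cancel x (+ m))))) ⟩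
  binom (x + + m + + t) m * rising (x + + m - + m) t
    ≡⟨ binom-upper-shift (x + + m) m t ⟩
  binom (x + + m) m * rising (x + + m) t ∎
  where
  open ≡-Reasoning
  assoc : ∀ x m t → x + + (m ℕ.+ t) ≡ x + + m + + t
  assoc x m t = trans (cong (_+_ x) (ℤP.pos-+ m t)) (sym (ℤP.+-assoc x (+ m) (+ t)))
  drop : ∀ x m t → x + + (m ℕ.+ t) - + m ≡ x + + t
  drop x m t = trans (cong (_- + m) (cong (_+_ x) (ℤP.pos-+ m t))) (ring x (+ m) (+ t))
    where ring : ∀ x m t → x + (m + t) - m ≡ x + t
          ring = solve-∀
  cancel : ∀ x m → x + m - m ≡ x
  cancel = solve-∀

binomℤ : ℤ → ℤ → ℤ
binomℤ c (+ k)    = binom c k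
binomℤ c -[1+ _ ] = 0ℤ

binomℤ-pascal : ∀ x z → binomℤ (x + + 1) (z + + 1) ≡ binomℤ x z + binomℤ x (z + + 1)
binomℤ-pascal x (+ k)         =
  subst (λ n → binom (x + + 1) n ≡ binom x k + binom x n) (ℕP.+-comm 1 k) (binom-pascal x k)
binomℤ-pascal x -[1+ zero ]   = refl
binomℤ-pascal x -[1+ suc _ ]  = refl

binomℤ-zero-neg : ∀ z → binomℤ (+ 0) (- z) ≡ binomℤ (+ 0) z
binomℤ-zero-neg (+ zero)  = refl
binomℤ-zero-neg (+ suc k) = sym (binom-zero k)
binomℤ-zero-neg -[1+ k ]  = binom-zero k

binomℤ-complement-pascal : ∀ c d →
  binomℤ (c + + 1) (c + + 1 - (d + + 1)) ≡ binomℤ c (c - d) + binomℤ c (c - (d + + 1))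
binomℤ-complement-pascal c d = begin
  binomℤ (c + + 1) (c + + 1 - (d + + 1))                      ≡⟨ cong (binomℤ (c + + 1)) (shift₁ c d) ⟩
  binomℤ (c + + 1) (c - (d + + 1) + + 1)                      ≡⟨ binomℤ-pascal c (c - (d + + 1)) ⟩
  binomℤ c (c - (d + + 1)) + binomℤ c (c - (d + + 1) + + 1)   ≡⟨ cong (λ z → binomℤ c (c - (d + + 1)) + binomℤ c z) (shift₂ c d) ⟩
  binomℤ c (c - (d + + 1)) + binomℤ c (c - d)                 ≡⟨ ℤP.+-comm (binomℤ c (c - (d + + 1))) _ ⟩
  binomℤ c (c - d) + binomℤ c (c - (d + + 1))                 ∎
  where
  open ≡-Reasoning
  shift₁ : ∀ c d → c + + 1 - (d + + 1) ≡ c - (d + + 1) + + 1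
  shift₁ = solve-∀
  shift₂ : ∀ c d → c - (d + + 1) + + 1 ≡ c - d
  shift₂ = solve-∀

binomℤ-nonneg : ∀ x z → + 0 ℤ.≤ z → binomℤ x z ≡ binom x ∣ z ∣
binomℤ-nonneg x (+ k) _ = refl

binomℤ-neg : ∀ x z → ¬ (+ 0 ℤ.≤ z) → binomℤ x z ≡ 0ℤ
binomℤ-neg x (+ k)    0≰k = contradiction (ℤ.+≤+ ℕ.z≤n) 0≰k
binomℤ-neg x -[1+ _ ] _   = refl

infix 4 _≡_mod_
record _≡_mod_ (x y m : ℤ) : Set where
  constructor congruent
  field ∣difference : m ∣ x - y

module _ {m : ℤ} where

  mod-reflexive : ∀ {x y} → x ≡ y → x ≡ y mod m
  mod-reflexive {x} refl = congruent (subst (m ∣_) (sym (ℤP.+-inverseʳ x)) (divides 0ℤ (sym (ℤP.*-zeroˡ m))))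

  mod-refl : ∀ {x} → x ≡ x mod m
  mod-refl = mod-reflexive refl

  mod-sym : ∀ {x y} → x ≡ y mod m → y ≡ x mod m
  mod-sym {x} {y} (congruent h) = congruent (subst (m ∣_) (negate x y) (ℤ∣.∣m⇒∣-m h))
    where negate : ∀ x y → - (x - y) ≡ y - x
          negate = solve-∀

  mod-trans : ∀ {x y z} → x ≡ y mod m → y ≡ z mod m → x ≡ z mod m
  mod-trans {x} {y} {z} (congruent h) (congruent h′) = congruent (subst (m ∣_) (telescope x y z) (ℤ∣.∣m∣n⇒∣m+n h h′))
    where telescope : ∀ x y z → x - y + (y - z) ≡ x - z
          telescope = solve-∀

  mod-mul : ∀ {x y u v} → x ≡ y mod m → u ≡ v mod m → x * u ≡ y * v mod m
  mod-mul {x} {y} {u} {v} (congruent h) (congruent h′) =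
    congruent (subst (m ∣_) (regroup x y u v) (ℤ∣.∣m∣n⇒∣m+n (ℤ∣.∣m⇒∣m*n u h) (ℤ∣.∣n⇒∣m*n y h′)))
    where regroup : ∀ x y u v → (x - y) * u + y * (u - v) ≡ x * u - y * v
          regroup = solve-∀

  mod-sub : ∀ {x y u v} → x ≡ y mod m → u ≡ v mod m → x - u ≡ y - v mod m
  mod-sub {x} {y} {u} {v} (congruent h) (congruent h′) = congruent (subst (m ∣_) (regroup x y u v) (ℤ∣.∣m∣n⇒∣m-n h h′))
    where regroup : ∀ x y u v → x - y - (u - v) ≡ x - u - (y - v)
          regroup = solve-∀

  ∣⇒≡0-mod : ∀ {x} → m ∣ x → x ≡ 0ℤ mod m
  ∣⇒≡0-mod {x} h = congruent (subst (m ∣_) (sym (ℤP.+-identityʳ x)) h)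

  ≡0-mod⇒∣ : ∀ {x} → x ≡ 0ℤ mod m → m ∣ x
  ≡0-mod⇒∣ {x} (congruent h) = subst (m ∣_) (ℤP.+-identityʳ x) h

  mod-∣ : ∀ {n x y} → m ∣ n → x ≡ y mod n → x ≡ y mod m
  mod-∣ m∣n (congruent h) = congruent (ℤ∣.∣-trans m∣n h)

  shift-mod : ∀ {y} z w → m ∣ y → y + z + w ≡ z + w mod m
  shift-mod {y} z w h = congruent (subst (m ∣_) (cancel y z w) h)
    where cancel : ∀ y z w → y ≡ y + z + w - (z + w)
          cancel = solve-∀

  falling-mod : ∀ {y} z t → m ∣ y → falling (y + z) t ≡ falling z t mod m
  falling-mod z zero    m∣y = mod-refl
  falling-mod z (suc t) m∣y = mod-mul (falling-mod z t m∣y) (shift-mod z (- + t) m∣y)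

  rising-mod : ∀ {y} z t → m ∣ y → rising (y + z) t ≡ rising z t mod m
  rising-mod z zero    m∣y = mod-refl
  rising-mod z (suc t) m∣y = mod-mul (rising-mod z t m∣y) (shift-mod z (+ suc t) m∣y)

mod-setoid : ℤ → Setoid _ _
mod-setoid m = record
  { Carrier       = ℤ
  ; _≈_           = λ x y → x ≡ y mod m
  ; isEquivalence = record { refl = mod-refl ; sym = mod-sym ; trans = mod-trans }
  }

module mod-Reasoning (m : ℤ) = SetoidReasoning (mod-setoid m)

binom-above-mod : ∀ {q} n k t → q ∣ + k → q ∣ n - + k → + (suc t !) * binom n (k ℕ.+ suc t) ≡ 0ℤ mod q
binom-above-mod {q} n k t q∣k q∣n-k = begin
  + (suc t !) * binom n (k ℕ.+ suc t)          ≡⟨ cong (_* binom n (k ℕ.+ suc t)) (rising-zero (suc t)) ⟨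
  rising (+ 0) (suc t) * binom n (k ℕ.+ suc t)  ≈⟨ mod-mul (rising-mod (+ 0) (suc t) q∣k) mod-refl ⟨
  rising (+ k + + 0) (suc t) * binom n (k ℕ.+ suc t)
    ≡⟨ cong (λ y → rising y (suc t) * binom n (k ℕ.+ suc t)) (ℤP.+-identityʳ (+ k)) ⟩
  rising (+ k) (suc t) * binom n (k ℕ.+ suc t)  ≡⟨ ℤP.*-comm (rising (+ k) (suc t)) _ ⟩
  binom n (k ℕ.+ suc t) * rising (+ k) (suc t)  ≡⟨ binom-lower-shift n k (suc t) ⟩
  binom n k * falling (n - + k) (suc t)
    ≈⟨ ∣⇒≡0-mod (ℤ∣.∣n⇒∣m*n (binom n k) (ℤ∣.∣-trans q∣n-k (∣falling (n - + k) t))) ⟩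
  0ℤ                                          ∎
  where open mod-Reasoning q

binom-below-mod : ∀ {q} n k t → q ∣ + k → q ∣ n - + k → suc t ℕ.≤ k →
                  + (suc t !) * binom n (k ℕ.∸ suc t) ≡ 0ℤ mod q
binom-below-mod {q} n k t q∣k q∣n-k t<k = begin
  + (suc t !) * binom n s                     ≡⟨ cong (_* binom n s) (falling-self (suc t)) ⟨
  falling (+ suc t) (suc t) * binom n s       ≈⟨ mod-mul (falling-mod (+ suc t) (suc t) q∣n-k) mod-refl ⟨
  falling (n - + k + + suc t) (suc t) * binom n s
    ≡⟨ cong (λ y → falling y (suc t) * binom n s) n-k+t≡n-s ⟩
  falling (n - + s) (suc t) * binom n s       ≡⟨ ℤP.*-comm (falling (n - + s) (suc t)) _ ⟩
  binom n s * falling (n - + s) (suc t)       ≡⟨ binom-lower-shift n s (suc t) ⟨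
  binom n (s ℕ.+ suc t) * rising (+ s) (suc t)
    ≈⟨ ∣⇒≡0-mod (ℤ∣.∣n⇒∣m*n (binom n (s ℕ.+ suc t)) (ℤ∣.∣n⇒∣m*n (rising (+ s) t) q∣s+t)) ⟩
  0ℤ                                         ∎
  where
  open mod-Reasoning q
  s = k ℕ.∸ suc t
  s+t≡k : s ℕ.+ suc t ≡ k
  s+t≡k = ℕP.m∸n+n≡m t<k
  q∣s+t : q ∣ + (s ℕ.+ suc t)
  q∣s+t = subst (λ k → q ∣ + k) (sym s+t≡k) q∣k
  n-k+t≡n-s : n - + k + + suc t ≡ n - + s
  n-k+t≡n-s = trans (cong (λ k → n - k + + suc t) (trans (cong +_ (sym s+t≡k)) (ℤP.pos-+ s (suc t)))) (cancel n (+ s) (+ suc t))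
    where cancel : ∀ n s t → n - (s + t) + t ≡ n - s
          cancel = solve-∀

binom-column-identity : ∀ q a b t .{{_ : ℕ.NonZero q}} →
  let n = + (a ℕ.* q); k = b ℕ.* q; x = n - + suc t in
  binom n k * rising (x - + k) t * (+ a - + b) ≡ binom x k * rising x t * + a
binom-column-identity q a b t = ℤP.*-cancelʳ-≡ _ _ (+ q) (begin
  binom n k * rising (x - + k) t * (+ a - + b) * + q
    ≡⟨ regroup₁ (binom n k) (rising (x - + k) t) (+ a - + b) (+ q) ⟩
  binom n k * (rising (x - + k) t * ((+ a - + b) * + q))
    ≡⟨ cong (λ z → binom n k * (rising (x - + k) t * z)) [a-b]q ⟩
  binom n k * rising (x - + k) (suc t)
    ≡⟨ cong (λ y → binom y k * rising (x - + k) (suc t)) x+t≡n ⟨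
  binom (x + + suc t) k * rising (x - + k) (suc t)
    ≡⟨ binom-upper-shift x k (suc t) ⟩
  binom x k * (rising x t * (x + + suc t))
    ≡⟨ cong (λ z → binom x k * (rising x t * z)) (trans x+t≡n (ℤP.pos-* a q)) ⟩
  binom x k * (rising x t * (+ a * + q))
    ≡⟨ regroup₂ (binom x k) (rising x t) (+ a) (+ q) ⟩
  binom x k * rising x t * + a * + q ∎)
  where
  open ≡-Reasoning
  n = + (a ℕ.* q)
  k = b ℕ.* q
  x = n - + suc t
  x+t≡n : x + + suc t ≡ n
  x+t≡n = cancel n (+ suc t)
    where cancel : ∀ n t → n - t + t ≡ n
          cancel = solve-∀
  [a-b]q : (+ a - + b) * + q ≡ x - + k + + suc t
  [a-b]q = trans (distrib (+ a) (+ b) (+ q)) (trans (cong₂ _-_ (sym (ℤP.pos-* a q)) (sym (ℤP.pos-* b q)))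
                 (sym (cancel n (+ k) (+ suc t))))
    where distrib : ∀ a b q → (a - b) * q ≡ a * q - b * q
          distrib = solve-∀
          cancel : ∀ n k t → n - t - k + t ≡ n - k
          cancel = solve-∀
  regroup₁ : ∀ u r d q → u * r * d * q ≡ u * (r * (d * q))
  regroup₁ = solve-∀
  regroup₂ : ∀ u r a q → u * (r * (a * q)) ≡ u * r * a * q
  regroup₂ = solve-∀

binom-column-mod : ∀ q a b t .{{_ : ℕ.NonZero q}} →
  rising -[1+ t ] t * (+ a * binom (+ (a ℕ.* q) - + suc t) (b ℕ.* q) - (+ a - + b) * binom (+ (a ℕ.* q)) (b ℕ.* q))
    ≡ 0ℤ mod + q
binom-column-mod q a b t = begin
  u * (+ a * binom x k - (+ a - + b) * binom n k)
    ≡⟨ distrib u (+ a * binom x k) ((+ a - + b) * binom n k) ⟩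
  u * (+ a * binom x k) - u * ((+ a - + b) * binom n k)
    ≈⟨ mod-sub (mod-mul (rising-mod -[1+ t ] t q∣n) mod-refl) (mod-mul rising-x-k mod-refl) ⟨
  rising x t * (+ a * binom x k) - rising (x - + k) t * ((+ a - + b) * binom n k)
    ≡⟨ regroup (binom n k) (binom x k) (rising x t) (rising (x - + k) t) (+ a) (+ a - + b) ⟩
  binom x k * rising x t * + a - binom n k * rising (x - + k) t * (+ a - + b)
    ≡⟨ cong (_-_ (binom x k * rising x t * + a)) (binom-column-identity q a b t) ⟩
  binom x k * rising x t * + a - binom x k * rising x t * + a
    ≡⟨ ℤP.+-inverseʳ (binom x k * rising x t * + a) ⟩
  0ℤ ∎
  where
  open mod-Reasoning (+ q)
  n = + (a ℕ.* q)
  k = b ℕ.* q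
  x = n - + suc t
  u = rising -[1+ t ] t
  q∣n : + q ∣ n
  q∣n = ℤ∣.∣ᵤ⇒∣ (ℕ∣.n∣m*n a)
  rising-x-k : rising (x - + k) t ≡ u mod + q
  rising-x-k = subst (λ y → rising y t ≡ u mod + q) (swap n (+ k) (+ suc t))
    (rising-mod -[1+ t ] t (ℤ∣.∣m∣n⇒∣m-n q∣n (ℤ∣.∣ᵤ⇒∣ {+ q} {+ k} (ℕ∣.n∣m*n b))))
    where swap : ∀ n k t → n - k + - t ≡ n - t - k
          swap = solve-∀
  distrib : ∀ u y z → u * (y - z) ≡ u * y - u * z
  distrib = solve-∀
  regroup : ∀ B B′ r r′ a c → r * (a * B′) - r′ * (c * B) ≡ B′ * r * a - B * r′ * c
  regroup = solve-∀

module _ {p : ℕ} where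

  private
    signed : ∀ {m} z → m ℕ∣.∣ ∣ z ∣ → + m ∣ z
    signed z = ℤ∣.∣ᵤ⇒∣

  p^m∣p^n : ∀ {m n} → m ℕ.≤ n → p ^ m ℕ∣.∣ p ^ n
  p^m∣p^n {m} {n} m≤n = ℕ∣.divides (p ^ (n ℕ.∸ m)) (begin
    p ^ n                     ≡⟨ cong (p ^_) (ℕP.m+[n∸m]≡n m≤n) ⟨
    p ^ (m ℕ.+ (n ℕ.∸ m))      ≡⟨ ℕP.^-distribˡ-+-* p m (n ℕ.∸ m) ⟩
    p ^ m ℕ.* p ^ (n ℕ.∸ m)    ≡⟨ ℕP.*-comm (p ^ m) _ ⟩
    p ^ (n ℕ.∸ m) ℕ.* p ^ m    ∎)
    where open ≡-Reasoning

  null-eventually : ∀ {x y} E₀ → (∀ e → E₀ ℕ.≤ e → x e ≡ y e) → PNull p x → PNull p y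
  null-eventually E₀ x≡y null-x N with null-x N
  ... | E , h = E ℕ.⊔ E₀ , λ e E⊔E₀≤e →
    subst (λ z → p ^ N ℕ∣.∣ ∣ z ∣) (x≡y e (ℕP.m⊔n≤o⇒n≤o E E₀ E⊔E₀≤e)) (h e (ℕP.m⊔n≤o⇒m≤o E E₀ E⊔E₀≤e))

  null-ext : ∀ {x y} → (∀ e → x e ≡ y e) → PNull p x → PNull p y
  null-ext x≡y = null-eventually 0 (λ e _ → x≡y e)

  null-zipWith : ∀ (_∙_ : ℤ → ℤ → ℤ) → (∀ {m u v} → m ∣ u → m ∣ v → m ∣ u ∙ v) →
                 ∀ x y → PNull p x → PNull p y → PNull p (λ e → x e ∙ y e)
  null-zipWith _∙_ ∣-∙ x y null-x null-y N with null-x N | null-y N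
  ... | E₁ , h₁ | E₂ , h₂ = E₁ ℕ.⊔ E₂ , λ e E₁⊔E₂≤e → ℤ∣.∣⇒∣ᵤ (∣-∙
    (signed (x e) (h₁ e (ℕP.m⊔n≤o⇒m≤o E₁ E₂ E₁⊔E₂≤e))) (signed (y e) (h₂ e (ℕP.m⊔n≤o⇒n≤o E₁ E₂ E₁⊔E₂≤e))))

  null-add : ∀ x y → PNull p x → PNull p y → PNull p (λ e → x e + y e)
  null-add = null-zipWith _+_ ℤ∣.∣m∣n⇒∣m+n

  null-sub : ∀ x y → PNull p x → PNull p y → PNull p (λ e → x e - y e)
  null-sub = null-zipWith _-_ ℤ∣.∣m∣n⇒∣m-n

  null-scale : ∀ k x → PNull p x → PNull p (λ e → k * x e)
  null-scale k x null-x N with null-x N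
  ... | E , h = E , λ e E≤e → ℤ∣.∣⇒∣ᵤ (ℤ∣.∣n⇒∣m*n k (signed (x e) (h e E≤e)))

  converges-ext : ∀ {x y} → (∀ e → x e ≡ y e) → PConverges p x → PConverges p y
  converges-ext x≡y conv-x N with conv-x N
  ... | E , h = E , λ e e′ E≤e E≤e′ → subst (λ z → p ^ N ℕ∣.∣ ∣ z ∣) (cong₂ _-_ (x≡y e) (x≡y e′)) (h e e′ E≤e E≤e′)

  null⇒converges : ∀ x → PNull p x → PConverges p x
  null⇒converges x null-x N with null-x N
  ... | E , h = E , λ e e′ E≤e E≤e′ → ℤ∣.∣⇒∣ᵤ (ℤ∣.∣m∣n⇒∣m-n (signed (x e) (h e E≤e)) (signed (x e′) (h e′ E≤e′)))

  converges-add : ∀ x y → PConverges p x → PConverges p y → PConverges p (λ e → x e + y e)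
  converges-add x y conv-x conv-y N with conv-x N | conv-y N
  ... | E₁ , h₁ | E₂ , h₂ = E₁ ℕ.⊔ E₂ , λ e e′ E₁⊔E₂≤e E₁⊔E₂≤e′ →
    ℤ∣.∣⇒∣ᵤ (subst (+ (p ^ N) ∣_) (regroup (x e) (x e′) (y e) (y e′)) (ℤ∣.∣m∣n⇒∣m+n
      (signed (x e - x e′) (h₁ e e′ (ℕP.m⊔n≤o⇒m≤o E₁ E₂ E₁⊔E₂≤e) (ℕP.m⊔n≤o⇒m≤o E₁ E₂ E₁⊔E₂≤e′)))
      (signed (y e - y e′) (h₂ e e′ (ℕP.m⊔n≤o⇒n≤o E₁ E₂ E₁⊔E₂≤e) (ℕP.m⊔n≤o⇒n≤o E₁ E₂ E₁⊔E₂≤e′)))))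
    where regroup : ∀ x x′ y y′ → x - x′ + (y - y′) ≡ x + y - (x′ + y′)
          regroup = solve-∀

  converges-scale : ∀ k x → PConverges p x → PConverges p (λ e → k * x e)
  converges-scale k x conv-x N with conv-x N
  ... | E , h = E , λ e e′ E≤e E≤e′ →
    ℤ∣.∣⇒∣ᵤ (subst (+ (p ^ N) ∣_) (distrib k (x e) (x e′)) (ℤ∣.∣n⇒∣m*n k (signed (x e - x e′) (h e e′ E≤e E≤e′))))
    where distrib : ∀ k x y → k * (x - y) ≡ k * x - k * y
          distrib = solve-∀

  converges-of-steps : ∀ {x} → (∀ e → x (suc e) ≡ x e mod + (p ^ e)) → PConverges p x
  converges-of-steps {x} step N = N , λ e e′ N≤e N≤e′ → ℤ∣.∣⇒∣ᵤ (_≡_mod_.∣difference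
    (mod-trans (from-anchor N≤e) (mod-sym (from-anchor N≤e′))))
    where
    anchored : ∀ k → x (N ℕ.+ k) ≡ x N mod + (p ^ N)
    anchored zero    = mod-reflexive (cong x (ℕP.+-identityʳ N))
    anchored (suc k) = mod-trans (subst (λ e → x e ≡ x (N ℕ.+ k) mod + (p ^ N)) (sym (ℕP.+-suc N k))
      (mod-∣ (signed (+ (p ^ (N ℕ.+ k))) (p^m∣p^n (ℕP.m≤m+n N k))) (step (N ℕ.+ k)))) (anchored k)
    from-anchor : ∀ {e} → N ℕ.≤ e → x e ≡ x N mod + (p ^ N)
    from-anchor {e} N≤e = subst (λ e → x e ≡ x N mod + (p ^ N)) (ℕP.m+[n∸m]≡n N≤e) (anchored (e ℕ.∸ N))

  pascal-null : ∀ (F : ℤ → ℤ → ℕ → ℤ) → (∀ c d e → F (c + + 1) (d + + 1) e ≡ F c d e + F c (d + + 1) e) →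
                (∀ d → PNull p (F (+ 0) d)) → (∀ m → PNull p (F -[1+ m ] (+ 0))) → ∀ c d → PNull p (F c d)
  pascal-null F pascal row₀ column = all
    where
    up : ∀ c d → PNull p (F c d) → PNull p (F c (d + + 1)) → PNull p (F (c + + 1) (d + + 1))
    up c d h h′ = null-ext (λ e → sym (pascal c d e)) (null-add (F c d) (F c (d + + 1)) h h′)

    right : ∀ c d → PNull p (F (c + + 1) (d + + 1)) → PNull p (F c d) → PNull p (F c (d + + 1))
    right c d h h′ = null-ext (λ e → trans (cong (_- F c d e) (pascal c d e)) (cancel (F c d e) _))
                               (null-sub (F (c + + 1) (d + + 1)) (F c d) h h′)
      where cancel : ∀ x y → x + y - x ≡ y
            cancel = solve-∀

    left : ∀ c d → PNull p (F (c + + 1) (d + + 1)) → PNull p (F c (d + + 1)) → PNull p (F c d)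
    left c d h h′ = null-ext (λ e → trans (cong (_- F c (d + + 1) e) (pascal c d e)) (cancel (F c d e) _))
                              (null-sub (F (c + + 1) (d + + 1)) (F c (d + + 1)) h h′)
      where cancel : ∀ x y → x + y - y ≡ x
            cancel = solve-∀

    row₊ : ∀ n d → PNull p (F (+ n) d)
    row₊ zero    d = row₀ d
    row₊ (suc n) d = subst₂ (λ c d → PNull p (F c d)) (cong +_ (ℕP.+-comm n 1)) (d-1+1 d)
      (up (+ n) (d - + 1) (row₊ n (d - + 1)) (subst (λ d → PNull p (F (+ n) d)) (sym (d-1+1 d)) (row₊ n d)))
      where d-1+1 : ∀ d → d - + 1 + + 1 ≡ d
            d-1+1 = solve-∀

    row₋ : ∀ c → (∀ d → PNull p (F (c + + 1) d)) → PNull p (F c (+ 0)) → ∀ d → PNull p (F c d)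
    row₋ c above at-0 (+ zero)     = at-0
    row₋ c above at-0 (+ suc k)    = subst (λ d → PNull p (F c d)) (cong +_ (ℕP.+-comm k 1))
                                       (right c (+ k) (above (+ k + + 1)) (row₋ c above at-0 (+ k)))
    row₋ c above at-0 -[1+ zero ]  = left c -[1+ 0 ] (above (+ 0)) at-0
    row₋ c above at-0 -[1+ suc j ] = left c -[1+ suc j ] (above -[1+ j ]) (row₋ c above at-0 -[1+ j ])

    all : ∀ c d → PNull p (F c d)
    all (+ n)          = row₊ n
    all -[1+ zero ]    = row₋ -[1+ 0 ] (row₊ 0) (column 0)
    all -[1+ suc m ]   = row₋ -[1+ suc m ] (all -[1+ m ]) (column (suc m))

module _ {p : ℕ} (p-prime : Prime p) where

  private instance
    p≢0 : ℕ.NonZero p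
    p≢0 = prime⇒nonZero p-prime

  n<p^n : ∀ n → n ℕ.< p ^ n
  n<p^n zero    = ℕ.s≤s ℕ.z≤n
  n<p^n (suc n) = ℕP.≤-<-trans (n<p^n n)
    (ℕP.^-monoʳ-< p (ℕ.nonTrivial⇒n>1 p {{prime⇒nonTrivial p-prime}}) (ℕP.n<1+n n))

  p^s∣m*n⇒p^s∣n : ∀ s {m n} → ¬ p ℕ∣.∣ m → p ^ s ℕ∣.∣ m ℕ.* n → p ^ s ℕ∣.∣ n
  p^s∣m*n⇒p^s∣n zero    p∤m _ = ℕ∣.1∣ _
  p^s∣m*n⇒p^s∣n (suc s) {m} {n} p∤m h with euclidsLemma m n p-prime (ℕ∣.∣-trans (ℕ∣.m∣m*n (p ^ s)) h)
  ... | inj₁ p∣m = contradiction p∣m p∤m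
  ... | inj₂ (ℕ∣.divides q refl) =
    subst (ℕ∣._∣ q ℕ.* p) (ℕP.*-comm (p ^ s) p) (ℕ∣.*-monoˡ-∣ p (p^s∣m*n⇒p^s∣n s p∤m (ℕ∣.*-cancelˡ-∣ p h′)))
    where
    h′ : p ℕ.* p ^ s ℕ∣.∣ p ℕ.* (m ℕ.* q)
    h′ = subst (p ℕ.* p ^ s ℕ∣.∣_) (trans (sym (ℕP.*-assoc m q p)) (ℕP.*-comm (m ℕ.* q) p)) h

  -- Possible because the exponent of p in u is below u.
  p^[s+u]∣m*u⇒p^s∣m : ∀ s {m u} → u ≢ 0 → p ^ (s ℕ.+ u) ℕ∣.∣ m ℕ.* u → p ^ s ℕ∣.∣ m
  p^[s+u]∣m*u⇒p^s∣m zero    u≢0 _ = ℕ∣.1∣ _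
  p^[s+u]∣m*u⇒p^s∣m (suc s) {m} {u} u≢0 h with p ℕ∣.∣? m
  ... | yes (ℕ∣.divides m′ refl) =
    subst (ℕ∣._∣ m′ ℕ.* p) (ℕP.*-comm (p ^ s) p) (ℕ∣.*-monoˡ-∣ p (p^[s+u]∣m*u⇒p^s∣m s {m′} u≢0 (ℕ∣.*-cancelˡ-∣ p h′)))
    where
    h′ : p ℕ.* p ^ (s ℕ.+ u) ℕ∣.∣ p ℕ.* (m′ ℕ.* u)
    h′ = subst (p ℕ.* p ^ (s ℕ.+ u) ℕ∣.∣_) (trans (ℕP.*-assoc m′ p u)
           (trans (cong (m′ ℕ.*_) (ℕP.*-comm p u)) (trans (sym (ℕP.*-assoc m′ u p)) (ℕP.*-comm (m′ ℕ.* u) p)))) h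
  ... | no p∤m = contradiction
    (ℕ∣.∣⇒≤ {{ℕ.≢-nonZero u≢0}} (p^s∣m*n⇒p^s∣n u p∤m (ℕ∣.∣-trans (p^m∣p^n (ℕP.m≤n+m u (suc s))) h)))
    (ℕP.<⇒≱ (n<p^n u))

  mod-cancelʳ : ∀ s {x y u} → ¬ + p ∣ u → x * u ≡ y * u mod + (p ^ s) → x ≡ y mod + (p ^ s)
  mod-cancelʳ s {x} {y} {u} p∤u (congruent h) = congruent (ℤ∣.∣ᵤ⇒∣ (p^s∣m*n⇒p^s∣n s (λ p∣u → p∤u (ℤ∣.∣ᵤ⇒∣ p∣u))
    (subst (p ^ s ℕ∣.∣_) (trans (ℤP.abs-* (x - y) u) (ℕP.*-comm ∣ x - y ∣ ∣ u ∣))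
      (ℤ∣.∣⇒∣ᵤ (subst (+ (p ^ s) ∣_) (factor x y u) h)))))
    where factor : ∀ x y u → x * u - y * u ≡ (x - y) * u
          factor = solve-∀

  private
    cancel-∣ : ∀ N {u} z → u ≢ 0ℤ → p ^ (N ℕ.+ ∣ u ∣) ℕ∣.∣ ∣ u * z ∣ → p ^ N ℕ∣.∣ ∣ z ∣
    cancel-∣ N {u} z u≢0 h = p^[s+u]∣m*u⇒p^s∣m N (λ ∣u∣≡0 → u≢0 (ℤP.∣i∣≡0⇒i≡0 ∣u∣≡0))
      (subst (p ^ (N ℕ.+ ∣ u ∣) ℕ∣.∣_) (trans (ℤP.abs-* u z) (ℕP.*-comm ∣ u ∣ ∣ z ∣)) h)

  null-cancel : ∀ {u} x → u ≢ 0ℤ → PNull p (λ e → u * x e) → PNull p x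
  null-cancel {u} x u≢0 null-ux N with null-ux (N ℕ.+ ∣ u ∣)
  ... | E , h = E , λ e E≤e → cancel-∣ N (x e) u≢0 (h e E≤e)

  converges-cancel : ∀ {u} x → u ≢ 0ℤ → PConverges p (λ e → u * x e) → PConverges p x
  converges-cancel {u} x u≢0 conv-ux N with conv-ux (N ℕ.+ ∣ u ∣)
  ... | E , h = E , λ e e′ E≤e E≤e′ →
    cancel-∣ N (x e - x e′) u≢0 (subst (λ z → p ^ (N ℕ.+ ∣ u ∣) ℕ∣.∣ ∣ z ∣) (factor u (x e) (x e′)) (h e e′ E≤e E≤e′))
    where factor : ∀ u y z → u * y - u * z ≡ u * (y - z)
          factor = solve-∀

  null-of-mod : ∀ {u} x E₀ → u ≢ 0ℤ → (∀ e → E₀ ℕ.≤ e → u * x e ≡ 0ℤ mod + (p ^ e)) → PNull p x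
  null-of-mod {u} x E₀ u≢0 h = null-cancel x u≢0 λ N → E₀ ℕ.⊔ N , λ e E₀⊔N≤e →
    ℤ∣.∣⇒∣ᵤ (ℤ∣.∣-trans (ℤ∣.∣ᵤ⇒∣ {+ (p ^ N)} {+ (p ^ e)} (p^m∣p^n (ℕP.m⊔n≤o⇒n≤o E₀ N E₀⊔N≤e)))
                       (≡0-mod⇒∣ (h e (ℕP.m⊔n≤o⇒m≤o E₀ N E₀⊔N≤e))))

  rising-p : ∀ y → rising y p ≡ rising y (ℕ.pred p) * (y + + p)
  rising-p y = subst (λ n → rising y n ≡ rising y (ℕ.pred p) * (y + + n)) (ℕP.suc-pred p) refl

  -- When p ∣ y, blocks y m collects the factors prime to p of rising y (p * m).
  blocks : ℤ → ℕ → ℤ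
  blocks y zero    = + 1
  blocks y (suc m) = blocks y m * rising (y + + (p ℕ.* m)) (ℕ.pred p)

  binom-diagonal-p-shift : ∀ x m →
    binom (x + + (m ℕ.+ p)) (m ℕ.+ p) * rising (+ m) (ℕ.pred p) * (+ m + + p)
      ≡ binom (x + + m) m * rising (x + + m) (ℕ.pred p) * (x + + m + + p)
  binom-diagonal-p-shift x m = begin
    binom (x + + (m ℕ.+ p)) (m ℕ.+ p) * rising (+ m) (ℕ.pred p) * (+ m + + p)
      ≡⟨ ℤP.*-assoc (binom (x + + (m ℕ.+ p)) (m ℕ.+ p)) _ _ ⟩
    binom (x + + (m ℕ.+ p)) (m ℕ.+ p) * (rising (+ m) (ℕ.pred p) * (+ m + + p))
      ≡⟨ cong (binom (x + + (m ℕ.+ p)) (m ℕ.+ p) *_) (rising-p (+ m)) ⟨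
    binom (x + + (m ℕ.+ p)) (m ℕ.+ p) * rising (+ m) p
      ≡⟨ binom-diagonal-shift x m p ⟩
    binom (x + + m) m * rising (x + + m) p
      ≡⟨ cong (binom (x + + m) m *_) (rising-p (x + + m)) ⟩
    binom (x + + m) m * (rising (x + + m) (ℕ.pred p) * (x + + m + + p))
      ≡⟨ ℤP.*-assoc (binom (x + + m) m) _ _ ⟨
    binom (x + + m) m * rising (x + + m) (ℕ.pred p) * (x + + m + + p) ∎
    where open ≡-Reasoning

  binom-scaled-identity : ∀ r m →
    binom (+ (p ℕ.* r ℕ.+ p ℕ.* m)) (p ℕ.* m) * blocks (+ 0) m ≡ binom (+ (r ℕ.+ m)) m * blocks (+ (p ℕ.* r)) m
  binom-scaled-identity r zero    rewrite ℕP.*-zeroʳ p = refl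
  binom-scaled-identity r (suc m) = ℤP.*-cancelʳ-≡ _ _ (+ (p ℕ.* suc m)) {{ℕP.m*n≢0 p (suc m)}} (begin
    binom (+ (R ℕ.+ p ℕ.* suc m)) (p ℕ.* suc m) * (U * B (+ M)) * + (p ℕ.* suc m)
      ≡⟨ cong (λ n → binom (+ (R ℕ.+ n)) n * (U * B (+ M)) * + n) p*[1+m] ⟩
    binom (+ R + + (M ℕ.+ p)) (M ℕ.+ p) * (U * B (+ M)) * (+ M + + p)
      ≡⟨ regroup₁ (binom (+ R + + (M ℕ.+ p)) (M ℕ.+ p)) U (B (+ M)) (+ M + + p) ⟩
    binom (+ R + + (M ℕ.+ p)) (M ℕ.+ p) * B (+ M) * (+ M + + p) * U
      ≡⟨ cong (_* U) (binom-diagonal-p-shift (+ R) M) ⟩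
    binom (+ R + + M) M * B (+ R + + M) * (+ R + + M + + p) * U
      ≡⟨ regroup₂ (binom (+ R + + M) M) (B (+ R + + M)) (+ R + + M + + p) U ⟩
    binom (+ R + + M) M * U * B (+ R + + M) * (+ R + + M + + p)
      ≡⟨ cong₂ (λ u z → u * B (+ R + + M) * z) (binom-scaled-identity r m) R+M+p ⟩
    binom (+ (r ℕ.+ m)) m * V * B (+ R + + M) * (+ p * (+ (r ℕ.+ m) + + 1))
      ≡⟨ regroup₃ (binom (+ (r ℕ.+ m)) m) V (B (+ R + + M)) (+ p) (+ (r ℕ.+ m) + + 1) ⟩
    binom (+ (r ℕ.+ m)) m * (+ (r ℕ.+ m) + + 1) * (V * B (+ R + + M)) * + p
      ≡⟨ cong (λ z → z * (V * B (+ R + + M)) * + p) (binom-absorb (+ (r ℕ.+ m)) m) ⟨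
    binom (+ (r ℕ.+ m) + + 1) (suc m) * + suc m * (V * B (+ R + + M)) * + p
      ≡⟨ regroup₄ (binom (+ (r ℕ.+ m) + + 1) (suc m)) (+ suc m) (V * B (+ R + + M)) (+ p) ⟩
    binom (+ (r ℕ.+ m) + + 1) (suc m) * (V * B (+ R + + M)) * (+ p * + suc m)
      ≡⟨ cong₂ (λ x z → binom x (suc m) * (V * B (+ R + + M)) * z) r+m+1 (sym (ℤP.pos-* p (suc m))) ⟩
    binom (+ (r ℕ.+ suc m)) (suc m) * (V * B (+ R + + M)) * + (p ℕ.* suc m) ∎)
    where
    open ≡-Reasoning
    R = p ℕ.* r
    M = p ℕ.* m
    U = blocks (+ 0) m
    V = blocks (+ R) m
    B : ℤ → ℤ
    B y = rising y (ℕ.pred p)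
    p*[1+m] : p ℕ.* suc m ≡ M ℕ.+ p
    p*[1+m] = trans (ℕP.*-suc p m) (ℕP.+-comm p M)
    R+M+p : + R + + M + + p ≡ + p * (+ (r ℕ.+ m) + + 1)
    R+M+p = trans (cong +_ (distrib p r m)) (ℤP.pos-* p (r ℕ.+ m ℕ.+ 1))
      where distrib : ∀ p r m → p ℕ.* r ℕ.+ p ℕ.* m ℕ.+ p ≡ p ℕ.* (r ℕ.+ m ℕ.+ 1)
            distrib = ℕ-Solver.solve-∀
    r+m+1 : + (r ℕ.+ m) + + 1 ≡ + (r ℕ.+ suc m)
    r+m+1 = cong +_ (trans (ℕP.+-assoc r m 1) (cong (r ℕ.+_) (ℕP.+-comm m 1)))
    regroup₁ : ∀ d u b z → d * (u * b) * z ≡ d * b * z * u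
    regroup₁ = solve-∀
    regroup₂ : ∀ d b z u → d * b * z * u ≡ d * u * b * z
    regroup₂ = solve-∀
    regroup₃ : ∀ d v b q w → d * v * b * (q * w) ≡ d * w * (v * b) * q
    regroup₃ = solve-∀
    regroup₄ : ∀ d s w q → d * s * w * q ≡ d * w * (q * s)
    regroup₄ = solve-∀

  blocks-mod : ∀ {M} y n → M ∣ y → blocks y n ≡ blocks (+ 0) n mod M
  blocks-mod y zero    M∣y = mod-refl
  blocks-mod y (suc n) M∣y = mod-mul (blocks-mod y n M∣y) (rising-mod (+ (p ℕ.* n)) (ℕ.pred p) M∣y)

  private
    p∤1 : ¬ + p ∣ + 1
    p∤1 p∣1 = ℕP.<⇒≢ (ℕ.nonTrivial⇒n>1 p {{prime⇒nonTrivial p-prime}}) (sym (ℕ∣.∣1⇒≡1 (ℤ∣.∣⇒∣ᵤ p∣1)))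

    p∤* : ∀ {x y} → ¬ + p ∣ x → ¬ + p ∣ y → ¬ + p ∣ x * y
    p∤* {x} {y} p∤x p∤y p∣xy with euclidsLemma ∣ x ∣ ∣ y ∣ p-prime (subst (p ℕ∣.∣_) (ℤP.abs-* x y) (ℤ∣.∣⇒∣ᵤ p∣xy))
    ... | inj₁ p∣x = p∤x (ℤ∣.∣ᵤ⇒∣ p∣x)
    ... | inj₂ p∣y = p∤y (ℤ∣.∣ᵤ⇒∣ p∣y)

  p∤rising : ∀ m t → t ℕ.< p → ¬ + p ∣ rising (+ (p ℕ.* m)) t
  p∤rising m zero    _   = p∤1
  p∤rising m (suc t) t<p = p∤* (p∤rising m t (ℕP.<-trans (ℕP.n<1+n t) t<p))
    λ p∣pm+t → ℕP.<⇒≱ t<p (ℕ∣.∣⇒≤ (ℕ∣.∣m+n∣m⇒∣n (ℤ∣.∣⇒∣ᵤ p∣pm+t) (ℕ∣.m∣m*n m)))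

  p∤blocks : ∀ n → ¬ + p ∣ blocks (+ 0) n
  p∤blocks zero    = p∤1
  p∤blocks (suc n) = p∤* (p∤blocks n) (p∤rising n (ℕ.pred p) (subst (ℕ.pred p ℕ.<_) (ℕP.suc-pred p) (ℕP.n<1+n (ℕ.pred p))))

  binom-scaled-mod : ∀ s r m → + (p ^ s) ∣ + (p ℕ.* r) →
    binom (+ (p ℕ.* r ℕ.+ p ℕ.* m)) (p ℕ.* m) ≡ binom (+ (r ℕ.+ m)) m mod + (p ^ s)
  binom-scaled-mod s r m p^s∣pr = mod-cancelʳ s (p∤blocks m)
    (mod-trans (mod-reflexive (binom-scaled-identity r m)) (mod-mul (mod-refl {x = binom (+ (r ℕ.+ m)) m}) (blocks-mod (+ (p ℕ.* r)) m p^s∣pr)))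

module _ {p : ℕ} (p-prime : Prime p) {a b : ℕ} (1≤b : 1 ℕ.≤ b) (b≤a : b ℕ.≤ a) where

  private instance
    p≢0 : ℕ.NonZero p
    p≢0 = prime⇒nonZero p-prime
    b≢0 : ℕ.NonZero b
    b≢0 = ℕ.>-nonZero 1≤b

  central : ℕ → ℤ
  central e = Seq p a b (+ 0) (+ 0) e

  -- Unlike Seq, which takes ∣ b p^e + d ∣ as lower index, this satisfies Pascal's rule for every e.
  Seqℤ : ℤ → ℤ → ℕ → ℤ
  Seqℤ c d e = binomℤ (+ (a ℕ.* p ^ e) + c) (+ (b ℕ.* p ^ e) + d)

  a≢0 : + a ≢ 0ℤ
  a≢0 a≡0 = ℕP.<⇒≢ (ℕP.<-≤-trans 1≤b b≤a) (sym (ℤP.+-injective a≡0))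

  p^e∣ : ∀ e c → + (p ^ e) ∣ + (c ℕ.* p ^ e)
  p^e∣ e c = ℤ∣.∣ᵤ⇒∣ {+ (p ^ e)} {+ (c ℕ.* p ^ e)} (ℕ∣.n∣m*n c)

  e≤b*p^e : ∀ e → e ℕ.≤ b ℕ.* p ^ e
  e≤b*p^e e = ℕP.≤-trans (ℕP.<⇒≤ (n<p^n p-prime e)) (ℕP.m≤n*m (p ^ e) b)

  central≡binom : ∀ e → central e ≡ binom (+ (a ℕ.* p ^ e)) (b ℕ.* p ^ e)
  central≡binom e = cong₂ binom (ℤP.+-identityʳ (+ (a ℕ.* p ^ e))) (ℕP.+-identityʳ (b ℕ.* p ^ e))

  Seq≡Seqℤ : ∀ c d e → ∣ d ∣ ℕ.≤ e → Seq p a b c d e ≡ Seqℤ c d e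
  Seq≡Seqℤ c (+ k)    e _   = refl
  Seq≡Seqℤ c -[1+ j ] e j<e rewrite ℤP.⊖-≥ (ℕP.≤-trans j<e (e≤b*p^e e)) = refl

  Seqℤ-pascal : ∀ c d e → Seqℤ (c + + 1) (d + + 1) e ≡ Seqℤ c d e + Seqℤ c (d + + 1) e
  Seqℤ-pascal c d e = begin
    binomℤ (n + (c + + 1)) (k + (d + + 1))         ≡⟨ cong₂ binomℤ (sym (ℤP.+-assoc n c (+ 1))) (sym (ℤP.+-assoc k d (+ 1))) ⟩
    binomℤ (n + c + + 1) (k + d + + 1)             ≡⟨ binomℤ-pascal (n + c) (k + d) ⟩
    binomℤ (n + c) (k + d) + binomℤ (n + c) (k + d + + 1) ≡⟨ cong (λ z → Seqℤ c d e + binomℤ (n + c) z) (ℤP.+-assoc k d (+ 1)) ⟩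
    Seqℤ c d e + Seqℤ c (d + + 1) e                ∎
    where
    open ≡-Reasoning
    n = + (a ℕ.* p ^ e)
    k = + (b ℕ.* p ^ e)

  central-step : ∀ e → central (suc e) ≡ central e mod + (p ^ suc e)
  central-step e = subst₂ (λ x y → x ≡ y mod + (p ^ suc e)) upper lower (binom-scaled-mod p-prime (suc e) r m p^[1+e]∣pr)
    where
    q = p ^ e
    r = (a ℕ.∸ b) ℕ.* q
    m = b ℕ.* q
    swap : ∀ p c q → p ℕ.* (c ℕ.* q) ≡ c ℕ.* (p ℕ.* q)
    swap = ℕ-Solver.solve-∀
    r+m≡aq : r ℕ.+ m ≡ a ℕ.* q
    r+m≡aq = trans (sym (ℕP.*-distribʳ-+ q (a ℕ.∸ b) b)) (cong (ℕ._* q) (ℕP.m∸n+n≡m b≤a))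
    upper : binom (+ (p ℕ.* r ℕ.+ p ℕ.* m)) (p ℕ.* m) ≡ central (suc e)
    upper = trans (cong₂ binom (cong +_ (trans (sym (ℕP.*-distribˡ-+ p r m)) (trans (cong (p ℕ.*_) r+m≡aq) (swap p a q))))
                               (swap p b q))
                  (sym (central≡binom (suc e)))
    lower : binom (+ (r ℕ.+ m)) m ≡ central e
    lower = trans (cong (λ n → binom (+ n) m) r+m≡aq) (sym (central≡binom e))
    p^[1+e]∣pr : + (p ^ suc e) ∣ + (p ℕ.* r)
    p^[1+e]∣pr = ℤ∣.∣ᵤ⇒∣ {+ (p ^ suc e)} {+ (p ℕ.* r)} (ℕ∣.divides (a ℕ.∸ b) (swap p (a ℕ.∸ b) q))

  central-converges : PConverges p central
  central-converges = converges-of-steps (λ e → mod-∣ (ℤ∣.∣ᵤ⇒∣ {+ (p ^ e)} {+ (p ^ suc e)} (ℕ∣.n∣m*n p)) (central-step e))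

  -- a times the ratio lim Seq c d / lim central predicted by the theorem.
  scaledRatio : ℤ → ℤ → ℤ
  scaledRatio (+ n)    d = + a * binomℤ (+ n) d
  scaledRatio -[1+ m ] d = (+ a - + b) * binomℤ -[1+ m ] d + + b * binomℤ -[1+ m ] (-[1+ m ] - d)

  scaledRatio-pascal : ∀ c d → scaledRatio (c + + 1) (d + + 1) ≡ scaledRatio c d + scaledRatio c (d + + 1)
  scaledRatio-pascal (+ n)         d =
    trans (cong (+ a *_) (binomℤ-pascal (+ n) d)) (ℤP.*-distribˡ-+ (+ a) (binomℤ (+ n) d) _)
  scaledRatio-pascal -[1+ suc m ]  d =
    trans (cong₂ (λ u v → (+ a - + b) * u + + b * v) (binomℤ-pascal c d) (binomℤ-complement-pascal c d))
          (regroup (+ a - + b) (+ b) (binomℤ c d) (binomℤ c (d + + 1)) (binomℤ c (c - d)) (binomℤ c (c - (d + + 1))))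
    where
    c = -[1+ suc m ]
    regroup : ∀ α β u v w x → α * (u + v) + β * (w + x) ≡ α * u + β * w + (α * v + β * x)
    regroup = solve-∀
  scaledRatio-pascal -[1+ zero ]   d = begin
    + a * binomℤ (+ 0) (d + + 1)
      ≡⟨ split (+ a) (+ b) (binomℤ (+ 0) (d + + 1)) ⟩
    (+ a - + b) * binomℤ (+ 0) (d + + 1) + + b * binomℤ (+ 0) (d + + 1)
      ≡⟨ cong (λ z → (+ a - + b) * binomℤ (+ 0) (d + + 1) + + b * z) (reflect (d + + 1)) ⟨
    (+ a - + b) * binomℤ (+ 0) (d + + 1) + + b * binomℤ (+ 0) (+ 0 - (d + + 1))
      ≡⟨ cong₂ (λ u v → (+ a - + b) * u + + b * v) (binomℤ-pascal c d) (binomℤ-complement-pascal c d) ⟩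
    (+ a - + b) * (binomℤ c d + binomℤ c (d + + 1)) + + b * (binomℤ c (c - d) + binomℤ c (c - (d + + 1)))
      ≡⟨ regroup (+ a - + b) (+ b) (binomℤ c d) (binomℤ c (d + + 1)) (binomℤ c (c - d)) (binomℤ c (c - (d + + 1))) ⟩
    scaledRatio c d + scaledRatio c (d + + 1) ∎
    where
    open ≡-Reasoning
    c = -[1+ 0 ]
    reflect : ∀ z → binomℤ (+ 0) (+ 0 - z) ≡ binomℤ (+ 0) z
    reflect z = trans (cong (binomℤ (+ 0)) (ℤP.+-identityˡ (- z))) (binomℤ-zero-neg z)
    split : ∀ a b x → a * x ≡ (a - b) * x + b * x
    split = solve-∀
    regroup : ∀ α β u v w x → α * (u + v) + β * (w + x) ≡ α * u + β * w + (α * v + β * x)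
    regroup = solve-∀

  defect : ℤ → ℤ → ℕ → ℤ
  defect c d e = + a * Seqℤ c d e - central e * scaledRatio c d

  defect-pascal : ∀ c d e → defect (c + + 1) (d + + 1) e ≡ defect c d e + defect c (d + + 1) e
  defect-pascal c d e = trans (cong₂ (λ s r → + a * s - central e * r) (Seqℤ-pascal c d e) (scaledRatio-pascal c d))
    (regroup (+ a) (central e) (Seqℤ c d e) (Seqℤ c (d + + 1) e) (scaledRatio c d) (scaledRatio c (d + + 1)))
    where regroup : ∀ α z s s′ r r′ → α * (s + s′) - z * (r + r′) ≡ α * s - z * r + (α * s′ - z * r′)
          regroup = solve-∀

  private
    factorial≢0 : ∀ n → + (n !) ≢ 0ℤ
    factorial≢0 n eq = ℕ.≢-nonZero⁻¹ (n !) {{n !≢0}} (ℤP.+-injective eq)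

    p^e∣n-k : ∀ e → + (p ^ e) ∣ + (a ℕ.* p ^ e) + + 0 - + (b ℕ.* p ^ e)
    p^e∣n-k e = ℤ∣.∣m∣n⇒∣m-n (ℤ∣.∣m∣n⇒∣m+n (p^e∣ e a) (divides 0ℤ refl)) (p^e∣ e b)

  Seqℤ-above-null : ∀ t → PNull p (Seqℤ (+ 0) (+ suc t))
  Seqℤ-above-null t = null-of-mod p-prime _ 0 (factorial≢0 (suc t))
    λ e _ → binom-above-mod (+ (a ℕ.* p ^ e) + + 0) (b ℕ.* p ^ e) t (p^e∣ e b) (p^e∣n-k e)

  Seqℤ-below-null : ∀ t → PNull p (Seqℤ (+ 0) -[1+ t ])
  Seqℤ-below-null t = null-of-mod p-prime _ (suc t) (factorial≢0 (suc t)) below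
    where
    below : ∀ e → suc t ℕ.≤ e → + (suc t !) * Seqℤ (+ 0) -[1+ t ] e ≡ 0ℤ mod + (p ^ e)
    below e t<e = subst (λ z → + (suc t !) * binomℤ (+ (a ℕ.* p ^ e) + + 0) z ≡ 0ℤ mod + (p ^ e)) (sym (ℤP.⊖-≥ t<k))
                        (binom-below-mod (+ (a ℕ.* p ^ e) + + 0) (b ℕ.* p ^ e) t (p^e∣ e b) (p^e∣n-k e) t<k)
      where t<k = ℕP.≤-trans t<e (e≤b*p^e e)

  defect-of-zero-ratio : ∀ c d → scaledRatio c d ≡ 0ℤ → ∀ e → + a * Seqℤ c d e ≡ defect c d e
  defect-of-zero-ratio c d ratio≡0 e = trans (vanish (+ a * Seqℤ c d e) (central e))
                                             (cong (λ r → + a * Seqℤ c d e - central e * r) (sym ratio≡0))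
    where vanish : ∀ x z → x ≡ x - z * 0ℤ
          vanish = solve-∀

  defect-row₀ : ∀ d → PNull p (defect (+ 0) d)
  defect-row₀ (+ zero)   = null-ext (λ e → vanish (+ a) (central e)) (λ N → 0 , λ e _ → ℕ∣._∣0 _)
    where vanish : ∀ α z → 0ℤ ≡ α * z - z * (α * + 1)
          vanish = solve-∀
  defect-row₀ (+ suc t)  = null-ext (defect-of-zero-ratio (+ 0) (+ suc t) (trans (cong (+ a *_) (binom-zero t)) (ℤP.*-zeroʳ (+ a))))
                                    (null-scale (+ a) _ (Seqℤ-above-null t))
  defect-row₀ -[1+ t ]   = null-ext (defect-of-zero-ratio (+ 0) -[1+ t ] (ℤP.*-zeroʳ (+ a)))
                                    (null-scale (+ a) _ (Seqℤ-below-null t))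

  defect-column : ∀ t → PNull p (defect -[1+ t ] (+ 0))
  defect-column t = null-of-mod p-prime _ 0 (rising-neg≢0 t) λ e _ →
    subst (λ z → rising -[1+ t ] t * z ≡ 0ℤ mod + (p ^ e)) (column-form e) (binom-column-mod (p ^ e) a b t {{ℕP.m^n≢0 p e}})
    where
    column-form : ∀ e → + a * binom (+ (a ℕ.* p ^ e) - + suc t) (b ℕ.* p ^ e) - (+ a - + b) * binom (+ (a ℕ.* p ^ e)) (b ℕ.* p ^ e)
                        ≡ defect -[1+ t ] (+ 0) e
    column-form e = trans (rearrange (+ a) (+ b) (binom (+ (a ℕ.* p ^ e) - + suc t) (b ℕ.* p ^ e)) (binom (+ (a ℕ.* p ^ e)) (b ℕ.* p ^ e)))
      (cong₂ (λ k z → + a * binom (+ (a ℕ.* p ^ e) - + suc t) k - z * ((+ a - + b) * + 1 + + b * 0ℤ))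
             (sym (ℕP.+-identityʳ (b ℕ.* p ^ e))) (sym (central≡binom e)))
      where rearrange : ∀ a b x y → a * x - (a - b) * y ≡ a * x - y * ((a - b) * + 1 + b * 0ℤ)
            rearrange = solve-∀

  defect-null : ∀ c d → PNull p (defect c d)
  defect-null = pascal-null defect defect-pascal defect-row₀ defect-column

  Seq-defect-null : ∀ c d → PNull p (λ e → + a * Seq p a b c d e - central e * scaledRatio c d)
  Seq-defect-null c d = null-eventually ∣ d ∣ (λ e d≤e → cong (λ s → + a * s - central e * scaledRatio c d) (sym (Seq≡Seqℤ c d e d≤e)))
                                        (defect-null c d)

  Seq-converges : ∀ c d → PConverges p (Seq p a b c d)
  Seq-converges c d = converges-cancel p-prime (Seq p a b c d) a≢0
    (converges-ext (λ e → restore (+ a * Seq p a b c d e) (central e) (scaledRatio c d))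
      (converges-add seq-defect (λ e → scaledRatio c d * central e)
                   (null⇒converges seq-defect (Seq-defect-null c d)) (converges-scale (scaledRatio c d) central central-converges)))
    where
    seq-defect : ℕ → ℤ
    seq-defect e = + a * Seq p a b c d e - central e * scaledRatio c d
    restore : ∀ x z r → x - z * r + r * z ≡ x
    restore = solve-∀

  Seq-null-of-zero-ratio : ∀ c d → scaledRatio c d ≡ 0ℤ → PNull p (Seq p a b c d)
  Seq-null-of-zero-ratio c d ratio≡0 = null-cancel p-prime (Seq p a b c d) a≢0
    (null-ext (λ e → trans (cong (λ r → + a * Seq p a b c d e - central e * r) ratio≡0) (vanish (+ a * Seq p a b c d e) (central e)))
              (Seq-defect-null c d))
    where vanish : ∀ x z → x - z * 0ℤ ≡ x
          vanish = solve-∀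

  limit-c≥0-d≥0 : ∀ c d → + 0 ℤ.≤ c → + 0 ℤ.≤ d →
                  PNull p (λ e → Seq p a b c d e - central e * binom c ∣ d ∣)
  limit-c≥0-d≥0 (+ n) (+ k) _ _ = null-cancel p-prime _ a≢0
    (null-ext (λ e → factor (+ a) (Seq p a b (+ n) (+ k) e) (central e) (binom (+ n) k)) (Seq-defect-null (+ n) (+ k)))
    where factor : ∀ α s z B → α * s - z * (α * B) ≡ α * (s - z * B)
          factor = solve-∀

  limit-c<0≤d : ∀ c d → c ℤ.< + 0 → + 0 ℤ.≤ d →
                PNull p (λ e → + a * Seq p a b c d e - central e * binom c ∣ d ∣ * (+ a - + b))
  limit-c<0≤d (+ _)    _     (ℤ.+<+ ()) _
  limit-c<0≤d -[1+ m ] (+ k) _ _ =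
    null-ext (λ e → trans (cong (λ r → + a * Seq p a b c (+ k) e - central e * r) (ratio k))
                          (regroup (+ a * Seq p a b c (+ k) e) (central e) (+ a - + b) (binom c k)))
             (Seq-defect-null c (+ k))
    where
    c = -[1+ m ]
    drop : ∀ x → x + + b * 0ℤ ≡ x
    drop x = trans (cong (_+_ x) (ℤP.*-zeroʳ (+ b))) (ℤP.+-identityʳ x)
    ratio : ∀ k → scaledRatio c (+ k) ≡ (+ a - + b) * binom c k
    ratio zero    = drop _
    ratio (suc k) = drop _
    regroup : ∀ x z α B → x - z * (α * B) ≡ x - z * B * α
    regroup = solve-∀

  limit-c<0≤c-d : ∀ c d → c ℤ.< + 0 → + 0 ℤ.≤ c - d →
                  PNull p (λ e → + a * Seq p a b c d e - central e * binom c ∣ c - d ∣ * + b)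
  limit-c<0≤c-d (+ _)    _          (ℤ.+<+ ()) _
  limit-c<0≤c-d -[1+ _ ] (+ zero)   _ ()
  limit-c<0≤c-d -[1+ _ ] (+ suc _)  _ ()
  limit-c<0≤c-d -[1+ m ] -[1+ j ] _ 0≤c-d =
    null-ext (λ e → trans (cong (λ B → + a * Seq p a b c d e - central e * ((+ a - + b) * 0ℤ + + b * B)) (binomℤ-nonneg c (c - d) 0≤c-d))
                          (regroup (+ a * Seq p a b c d e) (central e) (+ a - + b) (+ b) (binom c ∣ c - d ∣)))
             (Seq-defect-null c d)
    where
    c = -[1+ m ]
    d = -[1+ j ]
    regroup : ∀ x z α β B → x - z * (α * 0ℤ + β * B) ≡ x - z * B * β
    regroup = solve-∀

  limit-otherwise : ∀ c d → ¬ ((+ 0 ℤ.≤ c) × (+ 0 ℤ.≤ d)) → ¬ ((c ℤ.< + 0) × (+ 0 ℤ.≤ d)) →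
                    ¬ ((c ℤ.< + 0) × (+ 0 ℤ.≤ c - d)) → PNull p (Seq p a b c d)
  limit-otherwise (+ n)    (+ k)    ¬c≥0≤d _ _ = contradiction (ℤ.+≤+ ℕ.z≤n , ℤ.+≤+ ℕ.z≤n) ¬c≥0≤d
  limit-otherwise (+ n)    -[1+ j ] _ _ _      = Seq-null-of-zero-ratio (+ n) -[1+ j ] (ℤP.*-zeroʳ (+ a))
  limit-otherwise -[1+ m ] (+ k)    _ ¬c<0≤d _ = contradiction (ℤ.-<+ , ℤ.+≤+ ℕ.z≤n) ¬c<0≤d
  limit-otherwise -[1+ m ] -[1+ j ] _ _ ¬c<0≤c-d = Seq-null-of-zero-ratio -[1+ m ] -[1+ j ]
    (trans (cong (_+_ ((+ a - + b) * 0ℤ)) (trans (cong (+ b *_) (binomℤ-neg -[1+ m ] _ λ 0≤c-d → ¬c<0≤c-d (ℤ.-<+ , 0≤c-d)))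
                                               (ℤP.*-zeroʳ (+ b))))
           (trans (ℤP.+-identityʳ _) (ℤP.*-zeroʳ (+ a - + b))))

theorem1p5 : (p : ℕ) → Prime p → (a b : ℕ) → 1 ℕ.≤ b → b ℕ.≤ a →
  HasVal p (a ℕ.∸ b) 0 →
  (∃ λ k → (HasVal p a 0 × HasVal p b k) ⊎ (HasVal p a k × HasVal p b 0)) →
  (c d : ℤ) →
  PConverges p (λ e → Seq p a b (+ 0) (+ 0) e)
  × PConverges p (λ e → Seq p a b c d e)
  × ((+ 0 ℤ.≤ c) → (+ 0 ℤ.≤ d) →
       PNull p (λ e → Seq p a b c d e
                      ℤ.- Seq p a b (+ 0) (+ 0) e ℤ.* binom c ℤ.∣ d ∣))
  × ((c ℤ.< + 0) → (+ 0 ℤ.≤ d) →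
       PNull p (λ e → + a ℤ.* Seq p a b c d e
                      ℤ.- Seq p a b (+ 0) (+ 0) e ℤ.* binom c ℤ.∣ d ∣ ℤ.* (+ a ℤ.- + b)))
  × ((c ℤ.< + 0) → (+ 0 ℤ.≤ c ℤ.- d) →
       PNull p (λ e → + a ℤ.* Seq p a b c d e
                      ℤ.- Seq p a b (+ 0) (+ 0) e ℤ.* binom c ℤ.∣ c ℤ.- d ∣ ℤ.* + b))
  × (¬ ((+ 0 ℤ.≤ c) × (+ 0 ℤ.≤ d)) → ¬ ((c ℤ.< + 0) × (+ 0 ℤ.≤ d)) →
     ¬ ((c ℤ.< + 0) × (+ 0 ℤ.≤ c ℤ.- d)) →
       PNull p (λ e → Seq p a b c d e))
theorem1p5 p p-prime a b 1≤b b≤a _ _ c d =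
  central-converges p-prime 1≤b b≤a ,
  Seq-converges p-prime 1≤b b≤a c d ,
  limit-c≥0-d≥0 p-prime 1≤b b≤a c d ,
  limit-c<0≤d p-prime 1≤b b≤a c d ,
  limit-c<0≤c-d p-prime 1≤b b≤a c d ,
  limit-otherwise p-prime 1≤b b≤a c d
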